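{- Let $k\ge2$, $a_1,\dots,a_k\in\mathbb{Z}$ with $a_1>0$, and let $(f_n)_{n\ge0}$ be defined by $f_0=1$, $f_h=0$ for $h<0$, and $f_n=a_1f_{n-1}+\dots+a_kf_{n-k}$ for $n\ge1$. For $2\le i\le k$ define integers $q_i,r_i$ as follows: if $\sum_{l=1}^i a_l\le 0$, let $q_i,r_i$ be positive integers with $|\sum_{l=1}^i a_l|=q_ia_1-r_i$; otherwise let $q_i=0$ and $r_i=\sum_{l=1}^i a_l$. Consider the succession rule (all jumps equal to $1$) with label types $A$ (value $a_1$), $R_2,\dots,R_k$ ($R_i$ with value $r_i$) and $Z$ (value $0$), root $A$, and productions $$(a_1)\rightsquigarrow (0)^{q_2}(r_2)(a_1)^{a_1-(q_2+1)},$$ $$(r_i)\rightsquigarrow \big((0)^{q_2}(r_2)\big)^{q_i}(0)^{q_{i+1}}(r_{i+1})(a_1)^{r_i-(q_i(q_2+1)+q_{i+1}+1)}\quad (2\le i\le k-1),$$ $$(r_k)\rightsquigarrow \big((0)^{q_2}(r_2)\big)^{q_k}(0)^{q_k}(r_k)(a_1)^{r_k-(q_k(q_2+1)+q_k+1)},$$ where $(0)$ produces no children. That is: $A$ has $q_2$ children $Z$, one child $R_2$, and $a_1-(q_2+1)$ (signed) children $A$; for $2\le i\le k-1$, $R_i$ has $q_iq_2+q_{i+1}$ children $Z$, $q_i$ children $R_2$, one child $R_{i+1}$, and $r_i-(q_i(q_2+1)+q_{i+1}+1)$ (signed) children $A$; $R_k$ has $q_kq_2+q_k$ children $Z$, $q_k$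 children $R_2$, one child $R_k$, and $r_k-(q_k(q_2+1)+q_k+1)$ (signed) children $A$ (multiplicities of the same type being added); $Z$ has no children. Then the signed level counts $F_n$ of this rule satisfy $F_n=f_n$ for all $n\ge0$.
   Context: A succession rule (possibly with marked labels) is given by a set of label types, a root type, and for each pair of label types $t,t'$ an integer multiplicity $m(t,t')$. Its generating tree: the root has the root type, weight $+1$, level $0$; a node of type $t$ and weight $\varepsilon\in\{\pm1\}$ at level $n$ has, for each $t'$ with $m(t,t')\ne0$, exactly $|m(t,t')|$ children of type $t'$ at level $n+1$, each of weight $\varepsilon\cdot\mathrm{sign}(m(t,t'))$. The notation $(t)^m$ with $m<0$ denotes $|m|$ marked copies (weight $-1$). Distinct label types are kept distinct even if their numerical values coincide. The signed level count $F_n$ is the sum of the weights of all nodes (including nodes of type $Z$) at level $n$. -}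

module Defs where

open import Data.Nat as ℕ using (ℕ; zero; suc; _∸_; _≡ᵇ_; _<ᵇ_)
open import Data.Integer as ℤ using (ℤ; +_; -[1+_]; _+_; _*_; _-_)
open import Data.Bool using (Bool; true; false; if_then_else_)
open import Data.List using (List; []; _∷_; _++_; map; concatMap; replicate; upTo; foldr)
open import Data.Product using (_×_; _,_; proj₂)

sumFrom1 : (ℕ → ℤ) → ℕ → ℤ
sumFrom1 g zero    = + 0
sumFrom1 g (suc i) = sumFrom1 g i + g (suc i)

-- Label types A, R i (intended 2 ≤ i ≤ k), Z
data Label : Set where
  A : Label
  R : ℕ → Label
  Z : Label

labels : ℕ → List Label
labels k = A ∷ (map (λ j → R (2 ℕ.+ j)) (upTo (k ∸ 1)) ++ Z ∷ [])

-- sign of an integer as an integer (value at 0 is irrelevant)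
sgn : ℤ → ℤ
sgn (+ zero)  = + 0
sgn (+ suc _) = + 1
sgn -[1+ _ ]  = ℤ.- (+ 1)

next : ℕ → ℕ → ℕ
next k i = if i <ᵇ k then suc i else k

ind : Bool → ℤ
ind true  = + 1
ind false = + 0

mult : ℕ → ℤ → (ℕ → ℤ) → (ℕ → ℤ) → Label → Label → ℤ
mult k a1 q r A A     = a1 - (q 2 + + 1)
mult k a1 q r A (R j) = ind (j ≡ᵇ 2)
mult k a1 q r A Z     = q 2
-- (r_i) ⇝ ((0)^{q₂}(r₂))^{q_i} (0)^{q_{i'}} (r_{i'}) (a₁)^{r_i-(q_i(q₂+1)+q_{i'}+1)}
--   where i' = i+1 if i < k and i' = k if i = k; multiplicities of equal types added
mult k a1 q r (R i) A     = r i - (q i * (q 2 + + 1) + q (next k i) + + 1)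
mult k a1 q r (R i) (R j) = q i * ind (j ≡ᵇ 2) + ind (j ≡ᵇ next k i)
mult k a1 q r (R i) Z     = q i * q 2 + q (next k i)
mult k a1 q r Z _ = + 0

-- nodes of the generating tree: (type, weight)
Node : Set
Node = Label × ℤ

children : ℕ → ℤ → (ℕ → ℤ) → (ℕ → ℤ) → Node → List Node
children k a1 q r (t , ε) =
  concatMap (λ t' → replicate (ℤ.∣ mult k a1 q r t t' ∣) (t' , ε * sgn (mult k a1 q r t t')))
            (labels k)

level : ℕ → ℤ → (ℕ → ℤ) → (ℕ → ℤ) → ℕ → List Node
level k a1 q r zero    = (A , + 1) ∷ []
level k a1 q r (suc n) = concatMap (children k a1 q r) (level k a1 q r n)

F : ℕ → ℤ → (ℕ → ℤ) → (ℕ → ℤ) → ℕ → ℤ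
F k a1 q r n = foldr _+_ (+ 0) (map proj₂ (level k a1 q r n))

-- Let d_t(n) be the signed number of level-n descendants of a node of type t, so that F n = d_A(n),
-- and let e_i = d_{R_i} + q_i d_Z - (q_i + 1) d_A.  As r_i = q_i a_1 + S_i with S_i = a_1 + ... + a_i,
-- the productions give
--   d_A(n+1) = a_1 d_A(n) + e_2(n),   e_i(n+1) = S_i d_A(n) - d_A(n+1) + e_{i+1}(n)   (e_{k+1} := e_k),
-- with d_A(0) = 1 and e_i(0) = 0.  The same system, with the same initial values, is satisfied by f and
-- c_i(n) = Σ_{1≤j<i} ρ_j(n), where ρ_j(n) = Σ_{l>j} a_l f(n+j-l) are the companion-form remainders of the
-- recurrence; hence d_A = f.

module Submission where

open import Defs
open import Data.Nat as ℕ using (ℕ; zero; suc; pred; _∸_; _<ᵇ_; z≤n; s≤s)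
open import Data.Integer as ℤ using (ℤ; +_; -[1+_]; _+_; _*_; _-_; -_; _≤_; _<_; ∣_∣)
open import Data.Bool using (true; false; T)
open import Data.List using (List; []; _∷_; _++_; map; foldr; replicate; concatMap; upTo)
open import Data.List.Properties using (map-∘; map-upTo)
open import Data.Product using (_×_; _,_; proj₁; proj₂)
open import Data.Sum using (_⊎_; inj₁; inj₂)
open import Data.Unit using (tt)
open import Function using (_∘_)
open import Relation.Binary.PropositionalEquality
open import Relation.Nullary using (yes; no)
import Data.Nat.Properties as ℕₚ
import Data.Integer.Properties as ℤₚ
open import Data.Integer.Tactic.RingSolver using (solve-∀)

∑ : {A : Set} → List A → (A → ℤ) → ℤ
∑ xs h = foldr _+_ (+ 0) (map h xs)

module _ {A : Set} where

  ∑-cong : ∀ (xs : List A) {g h : A → ℤ} → (∀ x → g x ≡ h x) → ∑ xs g ≡ ∑ xs h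
  ∑-cong []       g≗h = refl
  ∑-cong (x ∷ xs) g≗h = cong₂ _+_ (g≗h x) (∑-cong xs g≗h)

  ∑-zero : ∀ (xs : List A) {h : A → ℤ} → (∀ x → h x ≡ + 0) → ∑ xs h ≡ + 0
  ∑-zero []       h≗0 = refl
  ∑-zero (x ∷ xs) h≗0 = cong₂ _+_ (h≗0 x) (∑-zero xs h≗0)

  ∑-++ : ∀ (xs ys : List A) h → ∑ (xs ++ ys) h ≡ ∑ xs h + ∑ ys h
  ∑-++ []       ys h = sym (ℤₚ.+-identityˡ _)
  ∑-++ (x ∷ xs) ys h = trans (cong (_+_ (h x)) (∑-++ xs ys h)) (sym (ℤₚ.+-assoc (h x) _ _))

  ∑-+ : ∀ (xs : List A) g h → ∑ xs (λ x → g x + h x) ≡ ∑ xs g + ∑ xs h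
  ∑-+ []       g h = refl
  ∑-+ (x ∷ xs) g h = trans (cong (_+_ (g x + h x)) (∑-+ xs g h)) (interchange (g x) (h x) _ _)
    where
    interchange : ∀ a b c d → a + b + (c + d) ≡ a + c + (b + d)
    interchange = solve-∀

  ∑-*ˡ : ∀ (xs : List A) c h → ∑ xs (λ x → c * h x) ≡ c * ∑ xs h
  ∑-*ˡ []       c h = sym (ℤₚ.*-zeroʳ c)
  ∑-*ˡ (x ∷ xs) c h = trans (cong (_+_ (c * h x)) (∑-*ˡ xs c h)) (sym (ℤₚ.*-distribˡ-+ c (h x) _))

  ∑-replicate : ∀ n (x : A) h → ∑ (replicate n x) h ≡ + n * h x
  ∑-replicate zero    x h = sym (ℤₚ.*-zeroˡ (h x))
  ∑-replicate (suc n) x h = trans (cong (_+_ (h x)) (∑-replicate n x h)) (sym (ℤₚ.suc-* (+ n) (h x)))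

  ∑-map : ∀ {B : Set} (g : B → A) xs h → ∑ (map g xs) h ≡ ∑ xs (h ∘ g)
  ∑-map g xs h = cong (foldr _+_ (+ 0)) (sym (map-∘ xs))

  ∑-concatMap : ∀ {B : Set} (g : B → List A) xs h → ∑ (concatMap g xs) h ≡ ∑ xs (λ y → ∑ (g y) h)
  ∑-concatMap g []       h = refl
  ∑-concatMap g (y ∷ ys) h = trans (∑-++ (g y) (concatMap g ys) h) (cong (_+_ (∑ (g y) h)) (∑-concatMap g ys h))

∑-upTo-suc : ∀ n h → ∑ (upTo (suc n)) h ≡ h 0 + ∑ (upTo n) (h ∘ suc)
∑-upTo-suc n h = cong (_+_ (h 0)) (trans (cong (λ xs → ∑ xs h) (sym (map-upTo suc n))) (∑-map suc (upTo n) h))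

∑-upTo-δ : ∀ n d (u : ℕ → ℤ) → d ℕ.< n → ∑ (upTo n) (λ j → ind (j ℕ.≡ᵇ d) * u j) ≡ u d
∑-upTo-δ (suc n) zero u _ = begin
  ∑ (upTo (suc n)) (λ j → ind (j ℕ.≡ᵇ 0) * u j)  ≡⟨ ∑-upTo-suc n (λ j → ind (j ℕ.≡ᵇ 0) * u j) ⟩
  + 1 * u 0 + ∑ (upTo n) (λ j → + 0 * u (suc j))  ≡⟨ cong₂ _+_ (ℤₚ.*-identityˡ (u 0)) (∑-zero (upTo n) (ℤₚ.*-zeroˡ ∘ u ∘ suc)) ⟩
  u 0 + + 0                                       ≡⟨ ℤₚ.+-identityʳ (u 0) ⟩
  u 0                                             ∎
  where open ≡-Reasoning
∑-upTo-δ (suc n) (suc d) u (s≤s d<n) = begin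
  ∑ (upTo (suc n)) (λ j → ind (j ℕ.≡ᵇ suc d) * u j)      ≡⟨ ∑-upTo-suc n (λ j → ind (j ℕ.≡ᵇ suc d) * u j) ⟩
  + 0 * u 0 + ∑ (upTo n) (λ j → ind (j ℕ.≡ᵇ d) * u (suc j)) ≡⟨ ℤₚ.+-identityˡ _ ⟩
  ∑ (upTo n) (λ j → ind (j ℕ.≡ᵇ d) * u (suc j))           ≡⟨ ∑-upTo-δ n d (u ∘ suc) d<n ⟩
  u (suc d)                                               ∎
  where open ≡-Reasoning

∣x∣*sgn[x]≡x : ∀ x → + ∣ x ∣ * sgn x ≡ x
∣x∣*sgn[x]≡x (+ zero)  = refl
∣x∣*sgn[x]≡x (+ suc n) = ℤₚ.*-identityʳ (+ suc n)
∣x∣*sgn[x]≡x -[1+ n ]  = cong -[1+_] (ℕₚ.*-identityʳ n)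

∑-labels : ∀ k h → ∑ (labels k) h ≡ h A + ∑ (upTo (k ∸ 1)) (λ d → h (R (2 ℕ.+ d))) + h Z
∑-labels k h = begin
  h A + ∑ (Rs ++ Z ∷ []) h       ≡⟨ cong (_+_ (h A)) (∑-++ Rs (Z ∷ []) h) ⟩
  h A + (∑ Rs h + (h Z + + 0))   ≡⟨ cong (λ s → h A + (s + (h Z + + 0))) (∑-map (λ d → R (2 ℕ.+ d)) (upTo (k ∸ 1)) h) ⟩
  h A + (∑R + (h Z + + 0))        ≡⟨ reassoc (h A) ∑R (h Z) ⟩
  h A + ∑R + h Z                  ∎
  where
  open ≡-Reasoning
  Rs = map (λ d → R (2 ℕ.+ d)) (upTo (k ∸ 1))
  ∑R = ∑ (upTo (k ∸ 1)) (λ d → h (R (2 ℕ.+ d)))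
  reassoc : ∀ x y z → x + (y + (z + + 0)) ≡ x + y + z
  reassoc = solve-∀

∑-R-δ : ∀ k c (u : ℕ → ℤ) → 2 ℕ.≤ c → c ℕ.≤ k →
  ∑ (upTo (k ∸ 1)) (λ d → ind (2 ℕ.+ d ℕ.≡ᵇ c) * u (2 ℕ.+ d)) ≡ u c
∑-R-δ k (suc (suc d)) u (s≤s (s≤s z≤n)) c≤k =
  ∑-upTo-δ (k ∸ 1) d (u ∘ (2 ℕ.+_)) (ℕₚ.∸-monoˡ-≤ 1 c≤k)

module GeneratingTree (k : ℕ) (a₁ : ℤ) (q r : ℕ → ℤ) where

  m : Label → Label → ℤ
  m = mult k a₁ q r

  desc : Label → ℕ → ℤ
  desc t zero    = + 1
  desc t (suc j) = ∑ (labels k) (λ t′ → m t t′ * desc t′ j)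

  nodeWeight : ℕ → Node → ℤ
  nodeWeight j (t , ε) = ε * desc t j

  ∑-children : ∀ j x → ∑ (children k a₁ q r x) (nodeWeight j) ≡ nodeWeight (suc j) x
  ∑-children j (t , ε) = begin
    ∑ (concatMap copies (labels k)) (nodeWeight j)
      ≡⟨ ∑-concatMap copies (labels k) (nodeWeight j) ⟩
    ∑ (labels k) (λ t′ → ∑ (copies t′) (nodeWeight j))
      ≡⟨ ∑-cong (labels k) copiesWeight ⟩
    ∑ (labels k) (λ t′ → ε * (m t t′ * desc t′ j))
      ≡⟨ ∑-*ˡ (labels k) ε (λ t′ → m t t′ * desc t′ j) ⟩
    ε * desc t (suc j) ∎
    where
    open ≡-Reasoning
    copies : Label → List Node
    copies t′ = replicate ∣ m t t′ ∣ (t′ , ε * sgn (m t t′))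
    regroup : ∀ c e s d → c * (e * s * d) ≡ e * (c * s * d)
    regroup = solve-∀
    copiesWeight : ∀ t′ → ∑ (copies t′) (nodeWeight j) ≡ ε * (m t t′ * desc t′ j)
    copiesWeight t′ = begin
      ∑ (copies t′) (nodeWeight j)                     ≡⟨ ∑-replicate ∣ m t t′ ∣ (t′ , ε * sgn (m t t′)) (nodeWeight j) ⟩
      + ∣ m t t′ ∣ * (ε * sgn (m t t′) * desc t′ j)     ≡⟨ regroup (+ ∣ m t t′ ∣) ε (sgn (m t t′)) (desc t′ j) ⟩
      ε * (+ ∣ m t t′ ∣ * sgn (m t t′) * desc t′ j)     ≡⟨ cong (λ c → ε * (c * desc t′ j)) (∣x∣*sgn[x]≡x (m t t′)) ⟩
      ε * (m t t′ * desc t′ j)                         ∎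

  ∑-level : ∀ n j → ∑ (level k a₁ q r n) (nodeWeight j) ≡ desc A (n ℕ.+ j)
  ∑-level zero    j = trans (ℤₚ.+-identityʳ _) (ℤₚ.*-identityˡ (desc A j))
  ∑-level (suc n) j = begin
    ∑ (concatMap (children k a₁ q r) (level k a₁ q r n)) (nodeWeight j)
      ≡⟨ ∑-concatMap (children k a₁ q r) (level k a₁ q r n) (nodeWeight j) ⟩
    ∑ (level k a₁ q r n) (λ x → ∑ (children k a₁ q r x) (nodeWeight j))
      ≡⟨ ∑-cong (level k a₁ q r n) (∑-children j) ⟩
    ∑ (level k a₁ q r n) (nodeWeight (suc j))
      ≡⟨ ∑-level n (suc j) ⟩
    desc A (n ℕ.+ suc j)
      ≡⟨ cong (desc A) (ℕₚ.+-suc n j) ⟩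
    desc A (suc n ℕ.+ j) ∎
    where open ≡-Reasoning

  F≡desc : ∀ n → F k a₁ q r n ≡ desc A n
  F≡desc n = begin
    ∑ (level k a₁ q r n) proj₂           ≡⟨ ∑-cong (level k a₁ q r n) (λ (_ , ε) → sym (ℤₚ.*-identityʳ ε)) ⟩
    ∑ (level k a₁ q r n) (nodeWeight 0)  ≡⟨ ∑-level n 0 ⟩
    desc A (n ℕ.+ 0)                     ≡⟨ cong (desc A) (ℕₚ.+-identityʳ n) ⟩
    desc A n                             ∎
    where open ≡-Reasoning

  desc-Z-suc : ∀ j → desc Z (suc j) ≡ + 0
  desc-Z-suc j = ∑-zero (labels k) (λ t′ → ℤₚ.*-zeroˡ (desc t′ j))

  desc-A-suc : 2 ℕ.≤ k → ∀ j →
    desc A (suc j) ≡ (a₁ - (q 2 + + 1)) * desc A j + desc (R 2) j + q 2 * desc Z j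
  desc-A-suc 2≤k j = trans (∑-labels k (λ t′ → m A t′ * desc t′ j))
    (cong (λ x → (a₁ - (q 2 + + 1)) * desc A j + x + q 2 * desc Z j)
          (∑-R-δ k 2 (λ c → desc (R c) j) ℕₚ.≤-refl 2≤k))

  desc-R-suc : ∀ i → 2 ℕ.≤ k → 2 ℕ.≤ next k i → next k i ℕ.≤ k → ∀ j →
    desc (R i) (suc j) ≡ (r i - (q i * (q 2 + + 1) + q (next k i) + + 1)) * desc A j
      + (q i * desc (R 2) j + desc (R (next k i)) j) + (q i * q 2 + q (next k i)) * desc Z j
  desc-R-suc i 2≤k 2≤i′ i′≤k j = trans (∑-labels k (λ t′ → m (R i) t′ * desc t′ j))
    (cong (λ x → m (R i) A * desc A j + x + m (R i) Z * desc Z j) ∑Rs)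
    where
    open ≡-Reasoning
    i′ = next k i
    u : ℕ → ℤ
    u c = desc (R c) j
    δ : ℕ → ℕ → ℤ
    δ c d = ind (2 ℕ.+ d ℕ.≡ᵇ c)
    ∑Rs : ∑ (upTo (k ∸ 1)) (λ d → (q i * δ 2 d + δ i′ d) * u (2 ℕ.+ d)) ≡ q i * u 2 + u i′
    ∑Rs = begin
      ∑ (upTo (k ∸ 1)) (λ d → (q i * δ 2 d + δ i′ d) * u (2 ℕ.+ d))
        ≡⟨ ∑-cong (upTo (k ∸ 1)) (λ d → trans (ℤₚ.*-distribʳ-+ (u (2 ℕ.+ d)) (q i * δ 2 d) (δ i′ d))
                                              (cong (_+ δ i′ d * u (2 ℕ.+ d)) (ℤₚ.*-assoc (q i) (δ 2 d) (u (2 ℕ.+ d))))) ⟩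
      ∑ (upTo (k ∸ 1)) (λ d → q i * (δ 2 d * u (2 ℕ.+ d)) + δ i′ d * u (2 ℕ.+ d))
        ≡⟨ ∑-+ (upTo (k ∸ 1)) (λ d → q i * (δ 2 d * u (2 ℕ.+ d))) (λ d → δ i′ d * u (2 ℕ.+ d)) ⟩
      ∑ (upTo (k ∸ 1)) (λ d → q i * (δ 2 d * u (2 ℕ.+ d))) + ∑ (upTo (k ∸ 1)) (λ d → δ i′ d * u (2 ℕ.+ d))
        ≡⟨ cong₂ _+_ (∑-*ˡ (upTo (k ∸ 1)) (q i) (λ d → δ 2 d * u (2 ℕ.+ d))) (∑-R-δ k i′ u 2≤i′ i′≤k) ⟩
      q i * ∑ (upTo (k ∸ 1)) (λ d → δ 2 d * u (2 ℕ.+ d)) + u i′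
        ≡⟨ cong (λ x → q i * x + u i′) (∑-R-δ k 2 u ℕₚ.≤-refl 2≤k) ⟩
      q i * u 2 + u i′ ∎

  defect : ℕ → ℕ → ℤ
  defect i j = desc (R i) j + q i * desc Z j - (q i + + 1) * desc A j

  defect-initial : ∀ i → defect i 0 ≡ + 0
  defect-initial i = cancel (q i)
    where
    cancel : ∀ x → + 1 + x * + 1 - (x + + 1) * + 1 ≡ + 0
    cancel = solve-∀

  desc-A-suc-defect : 2 ℕ.≤ k → ∀ j → desc A (suc j) ≡ a₁ * desc A j + defect 2 j
  desc-A-suc-defect 2≤k j = trans (desc-A-suc 2≤k j) (regroup a₁ (q 2) (desc A j) (desc (R 2) j) (desc Z j))
    where
    regroup : ∀ a q GA G2 GZ → (a - (q + + 1)) * GA + G2 + q * GZ ≡ a * GA + (G2 + q * GZ - (q + + 1) * GA)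
    regroup = solve-∀

  defect-suc : ∀ i → 2 ℕ.≤ k → 2 ℕ.≤ next k i → next k i ℕ.≤ k → ∀ s → r i ≡ q i * a₁ + s → ∀ j →
    defect i (suc j) ≡ s * desc A j - desc A (suc j) + defect (next k i) j
  defect-suc i 2≤k 2≤i′ i′≤k s r≡ j = begin
    defect i (suc j)
      ≡⟨ cong₂ (λ x y → x + q i * y - (q i + + 1) * desc A (suc j))
               (desc-R-suc i 2≤k 2≤i′ i′≤k j) (desc-Z-suc j) ⟩
    (r i - (q i * (q 2 + + 1) + q i′ + + 1)) * GA + (q i * G2 + Gi′) + (q i * q 2 + q i′) * GZ
      + q i * + 0 - (q i + + 1) * desc A (suc j)
      ≡⟨ cong₂ (λ x y → (x - (q i * (q 2 + + 1) + q i′ + + 1)) * GA + (q i * G2 + Gi′) + (q i * q 2 + q i′) * GZ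
                          + q i * + 0 - (q i + + 1) * y)
               r≡ (desc-A-suc 2≤k j) ⟩
    (q i * a₁ + s - (q i * (q 2 + + 1) + q i′ + + 1)) * GA + (q i * G2 + Gi′) + (q i * q 2 + q i′) * GZ
      + q i * + 0 - (q i + + 1) * ((a₁ - (q 2 + + 1)) * GA + G2 + q 2 * GZ)
      ≡⟨ absorb (q i) (q 2) (q i′) a₁ s GA G2 Gi′ GZ ⟩
    s * GA - ((a₁ - (q 2 + + 1)) * GA + G2 + q 2 * GZ) + defect i′ j
      ≡⟨ cong (λ y → s * GA - y + defect i′ j) (sym (desc-A-suc 2≤k j)) ⟩
    s * GA - desc A (suc j) + defect i′ j ∎
    where
    open ≡-Reasoning
    i′ = next k i
    GA = desc A j
    G2 = desc (R 2) j
    Gi′ = desc (R i′) j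
    GZ = desc Z j
    -- Since r i = q i a₁ + s, the production of R i contains q i copies of the production of A.
    absorb : ∀ qi q2 qi′ a s GA G2 Gi′ GZ →
      (qi * a + s - (qi * (q2 + + 1) + qi′ + + 1)) * GA + (qi * G2 + Gi′) + (qi * q2 + qi′) * GZ
        + qi * + 0 - (qi + + 1) * ((a - (q2 + + 1)) * GA + G2 + q2 * GZ)
      ≡ s * GA - ((a - (q2 + + 1)) * GA + G2 + q2 * GZ) + (Gi′ + qi′ * GZ - (qi′ + + 1) * GA)
    absorb = solve-∀

sumFrom1-cong : ∀ n {g h : ℕ → ℤ} → (∀ l → 1 ℕ.≤ l → l ℕ.≤ n → g l ≡ h l) → sumFrom1 g n ≡ sumFrom1 h n
sumFrom1-cong zero    g≗h = refl
sumFrom1-cong (suc n) g≗h =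
  cong₂ _+_ (sumFrom1-cong n (λ l 1≤l l≤n → g≗h l 1≤l (ℕₚ.m≤n⇒m≤1+n l≤n))) (g≗h (suc n) (s≤s z≤n) ℕₚ.≤-refl)

sumFrom1-zero : ∀ n → sumFrom1 (λ _ → + 0) n ≡ + 0
sumFrom1-zero zero    = refl
sumFrom1-zero (suc n) = cong (_+ + 0) (sumFrom1-zero n)

sumFrom1-suc : ∀ n (g : ℕ → ℤ) → sumFrom1 g (suc n) ≡ g 1 + sumFrom1 (g ∘ suc) n
sumFrom1-suc zero    g = trans (ℤₚ.+-identityˡ (g 1)) (sym (ℤₚ.+-identityʳ (g 1)))
sumFrom1-suc (suc n) g = trans (cong (_+ g (2 ℕ.+ n)) (sumFrom1-suc n g)) (ℤₚ.+-assoc (g 1) _ _)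

sumFrom1-+ : ∀ n (g h : ℕ → ℤ) → sumFrom1 (λ l → g l + h l) n ≡ sumFrom1 g n + sumFrom1 h n
sumFrom1-+ zero    g h = refl
sumFrom1-+ (suc n) g h = trans (cong (_+ (g (suc n) + h (suc n))) (sumFrom1-+ n g h)) (interchange (sumFrom1 g n) (sumFrom1 h n) (g (suc n)) (h (suc n)))
  where
  interchange : ∀ a b c d → a + b + (c + d) ≡ a + c + (b + d)
  interchange = solve-∀

sumFrom1-*ʳ : ∀ n (g : ℕ → ℤ) c → sumFrom1 (λ l → g l * c) n ≡ sumFrom1 g n * c
sumFrom1-*ʳ zero    g c = sym (ℤₚ.*-zeroˡ c)
sumFrom1-*ʳ (suc n) g c =
  trans (cong (_+ g (suc n) * c) (sumFrom1-*ʳ n g c)) (sym (ℤₚ.*-distribʳ-+ c (sumFrom1 g n) (g (suc n))))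

[1+m]-[1+n]≡m-n : ∀ m n → + suc m - + suc n ≡ + m - + n
[1+m]-[1+n]≡m-n m n = begin
  + suc m - + suc n  ≡⟨ ℤₚ.m-n≡m⊖n (suc m) (suc n) ⟩
  suc m ℤ.⊖ suc n    ≡⟨ ℤₚ.[1+m]⊖[1+n]≡m⊖n m n ⟩
  m ℤ.⊖ n            ≡⟨ ℤₚ.m-n≡m⊖n m n ⟨
  + m - + n          ∎
  where open ≡-Reasoning

next-cases : ∀ {k i} → i ℕ.≤ k → (i ℕ.< k × next k i ≡ suc i) ⊎ (i ≡ k × next k i ≡ k)
next-cases {k} {i} i≤k with i <ᵇ k in eq
... | true  = inj₁ (ℕₚ.<ᵇ⇒< i k (subst T (sym eq) tt) , refl)
... | false = inj₂ (ℕₚ.≤∧≮⇒≡ i≤k (λ i<k → subst T eq (ℕₚ.<⇒<ᵇ i<k)) , refl)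

next-bounds : ∀ {k i} → 2 ℕ.≤ i → i ℕ.≤ k → 2 ℕ.≤ next k i × next k i ℕ.≤ k
next-bounds {k} {i} 2≤i i≤k with next-cases {k} {i} i≤k
... | inj₁ (i<k , next≡) = subst (2 ℕ.≤_) (sym next≡) (ℕₚ.m≤n⇒m≤1+n 2≤i) , subst (ℕ._≤ k) (sym next≡) i<k
... | inj₂ (i≡k , next≡) = subst (2 ℕ.≤_) (sym next≡) (subst (2 ℕ.≤_) i≡k 2≤i) , subst (ℕ._≤ k) (sym next≡) ℕₚ.≤-refl

module LinearRecurrence (k : ℕ) (a : ℕ → ℤ) (f : ℤ → ℤ)
  (f-neg : ∀ h → h < + 0 → f h ≡ + 0)
  (f-rec : ∀ n → 1 ℕ.≤ n → f (+ n) ≡ sumFrom1 (λ l → a l * f (+ n - + l)) k) where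

  -- ρ_j(n) = Σ_{l>j} a_l f(n+j-l), reindexed by l ↦ j + l.
  remainder : ℕ → ℕ → ℤ
  remainder j n = sumFrom1 (λ l → a (j ℕ.+ l) * f (+ n - + l)) (k ∸ j)

  remainder-initial : ∀ j → remainder j 0 ≡ + 0
  remainder-initial j = trans (sumFrom1-cong (k ∸ j) vanish) (sumFrom1-zero (k ∸ j))
    where
    vanish : ∀ l → 1 ℕ.≤ l → l ℕ.≤ k ∸ j → a (j ℕ.+ l) * f (+ 0 - + l) ≡ + 0
    vanish (suc l) _ _ = trans (cong (a (j ℕ.+ suc l) *_) (f-neg -[1+ l ] ℤ.-<+)) (ℤₚ.*-zeroʳ (a (j ℕ.+ suc l)))

  remainder-last : ∀ n → remainder k n ≡ + 0
  remainder-last n = cong (sumFrom1 (λ l → a (k ℕ.+ l) * f (+ n - + l))) (ℕₚ.n∸n≡0 k)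

  remainder-suc : ∀ {j} → j ℕ.< k → ∀ n → remainder j (suc n) ≡ a (suc j) * f (+ n) + remainder (suc j) n
  remainder-suc {j} j<k n = begin
    sumFrom1 g (k ∸ j)                    ≡⟨ cong (sumFrom1 g) (ℕₚ.+-∸-assoc 1 j<k) ⟩
    sumFrom1 g (suc (k ∸ suc j))          ≡⟨ sumFrom1-suc (k ∸ suc j) g ⟩
    g 1 + sumFrom1 (g ∘ suc) (k ∸ suc j)  ≡⟨ cong₂ _+_ first (sumFrom1-cong (k ∸ suc j) (λ l _ _ → later l)) ⟩
    a (suc j) * f (+ n) + remainder (suc j) n ∎
    where
    open ≡-Reasoning
    g : ℕ → ℤ
    g l = a (j ℕ.+ l) * f (+ suc n - + l)
    first : g 1 ≡ a (suc j) * f (+ n)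
    first = cong₂ (λ i x → a i * f x) (ℕₚ.+-comm j 1)
                  (trans ([1+m]-[1+n]≡m-n n 0) (ℤₚ.+-identityʳ (+ n)))
    later : ∀ l → g (suc l) ≡ a (suc j ℕ.+ l) * f (+ n - + l)
    later l = cong₂ (λ i x → a i * f x) (ℕₚ.+-suc j l) ([1+m]-[1+n]≡m-n n l)

  f-suc : 1 ℕ.≤ k → ∀ n → f (+ suc n) ≡ a 1 * f (+ n) + remainder 1 n
  f-suc 1≤k n = trans (f-rec (suc n) (s≤s z≤n)) (remainder-suc 1≤k n)

  -- state i = c_{i+1}
  state : ℕ → ℕ → ℤ
  state i n = sumFrom1 (λ j → remainder j n) i

  state-initial : ∀ i → state i 0 ≡ + 0
  state-initial i = trans (sumFrom1-cong i (λ j _ _ → remainder-initial j)) (sumFrom1-zero i)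

  state-suc : ∀ {i} → i ℕ.< k → ∀ n →
    state i (suc n) ≡ sumFrom1 a (suc i) * f (+ n) - f (+ suc n) + state (suc i) n
  state-suc {i} i<k n = begin
    state i (suc n)
      ≡⟨ sumFrom1-cong i (λ j _ j≤i → remainder-suc (ℕₚ.≤-<-trans j≤i i<k) n) ⟩
    sumFrom1 (λ j → a (suc j) * f (+ n) + remainder (suc j) n) i
      ≡⟨ sumFrom1-+ i (λ j → a (suc j) * f (+ n)) (λ j → remainder (suc j) n) ⟩
    sumFrom1 (λ j → a (suc j) * f (+ n)) i + sumFrom1 (λ j → remainder (suc j) n) i
      ≡⟨ cong (_+ sumFrom1 (λ j → remainder (suc j) n) i) (sumFrom1-*ʳ i (a ∘ suc) (f (+ n))) ⟩
    sumFrom1 (a ∘ suc) i * f (+ n) + sumFrom1 (λ j → remainder (suc j) n) i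
      ≡⟨ regroup (a 1) (sumFrom1 (a ∘ suc) i) (f (+ n)) (remainder 1 n) (sumFrom1 (λ j → remainder (suc j) n) i) ⟩
    (a 1 + sumFrom1 (a ∘ suc) i) * f (+ n) - (a 1 * f (+ n) + remainder 1 n)
      + (remainder 1 n + sumFrom1 (λ j → remainder (suc j) n) i)
      ≡⟨ cong₂ (λ x y → x * f (+ n) - y + (remainder 1 n + sumFrom1 (λ j → remainder (suc j) n) i))
               (sumFrom1-suc i a) (f-suc 1≤k n) ⟨
    sumFrom1 a (suc i) * f (+ n) - f (+ suc n) + (remainder 1 n + sumFrom1 (λ j → remainder (suc j) n) i)
      ≡⟨ cong (_+_ (sumFrom1 a (suc i) * f (+ n) - f (+ suc n))) (sumFrom1-suc i (λ j → remainder j n)) ⟨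
    sumFrom1 a (suc i) * f (+ n) - f (+ suc n) + state (suc i) n ∎
    where
    open ≡-Reasoning
    1≤k : 1 ℕ.≤ k
    1≤k = ℕₚ.≤-trans (s≤s z≤n) i<k
    regroup : ∀ a₁ s x t u → s * x + u ≡ (a₁ + s) * x - (a₁ * x + t) + (t + u)
    regroup = solve-∀

  state-next : ∀ {i} → 1 ℕ.≤ i → i ℕ.≤ k → ∀ n →
    state (pred i) (suc n) ≡ sumFrom1 a i * f (+ n) - f (+ suc n) + state (pred (next k i)) n
  state-next {suc i} _ i<k n with next-cases i<k
  ... | inj₁ (_ , next≡) rewrite next≡ = state-suc i<k n
  ... | inj₂ (refl , next≡) rewrite next≡ = trans (state-suc i<k n)
          (cong (_+_ (sumFrom1 a (suc i) * f (+ n) - f (+ suc n)))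
                (trans (cong (_+_ (state i n)) (remainder-last n)) (ℤₚ.+-identityʳ (state i n))))

r≡q*a+S : ∀ {S q r a} →
  (S ≤ + 0 → (+ 0 < q) × (+ 0 < r) × (+ ∣ S ∣ ≡ q * a - r)) × (+ 0 < S → (q ≡ + 0) × (r ≡ S)) →
  r ≡ q * a + S
r≡q*a+S {S} {q} {r} {a} (nonpos , pos) with S ℤ.≤? + 0
... | yes S≤0 = begin
  r                ≡⟨ cancel (q * a) r ⟨
  q * a - (q * a - r)  ≡⟨ cong (_-_ (q * a)) (proj₂ (proj₂ (nonpos S≤0))) ⟨
  q * a - + ∣ S ∣  ≡⟨ cong (_-_ (q * a)) (∣x∣≡-x S S≤0) ⟩
  q * a - - S      ≡⟨ cong (_+_ (q * a)) (ℤₚ.neg-involutive S) ⟩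
  q * a + S        ∎
  where
  open ≡-Reasoning
  cancel : ∀ x y → x - (x - y) ≡ y
  cancel = solve-∀
  ∣x∣≡-x : ∀ x → x ≤ + 0 → + ∣ x ∣ ≡ - x
  ∣x∣≡-x (+ zero)  _        = refl
  ∣x∣≡-x -[1+ n ]  _        = refl
  ∣x∣≡-x (+ suc n) (ℤ.+≤+ ())
... | no S≰0 with pos (ℤₚ.≰⇒> S≰0)
... | q≡0 , r≡S = trans r≡S (sym (trans (cong (λ x → x * a + S) q≡0) (ℤₚ.+-identityˡ S)))

module Agreement (k : ℕ) (2≤k : 2 ℕ.≤ k) (a : ℕ → ℤ) (f : ℤ → ℤ)
  (f-neg : ∀ h → h < + 0 → f h ≡ + 0) (f-init : f (+ 0) ≡ + 1)
  (f-rec : ∀ n → 1 ℕ.≤ n → f (+ n) ≡ sumFrom1 (λ l → a l * f (+ n - + l)) k)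
  (q r : ℕ → ℤ) (r-split : ∀ i → 2 ℕ.≤ i → i ℕ.≤ k → r i ≡ q i * a 1 + sumFrom1 a i) where

  open GeneratingTree k (a 1) q r
  open LinearRecurrence k a f f-neg f-rec

  desc≡f×defect≡state : ∀ n → desc A n ≡ f (+ n) × (∀ i → 2 ℕ.≤ i → i ℕ.≤ k → defect i n ≡ state (pred i) n)
  desc≡f×defect≡state zero    = sym f-init , λ i _ _ → trans (defect-initial i) (sym (state-initial (pred i)))
  desc≡f×defect≡state (suc n) = desc≡f′ , defect≡state′
    where
    open ≡-Reasoning
    desc≡f = proj₁ (desc≡f×defect≡state n)
    defect≡state = proj₂ (desc≡f×defect≡state n)

    desc≡f′ : desc A (suc n) ≡ f (+ suc n)
    desc≡f′ = begin
      desc A (suc n)                 ≡⟨ desc-A-suc-defect 2≤k n ⟩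
      a 1 * desc A n + defect 2 n    ≡⟨ cong₂ (λ x y → a 1 * x + y) desc≡f (defect≡state 2 ℕₚ.≤-refl 2≤k) ⟩
      a 1 * f (+ n) + state 1 n      ≡⟨ cong (_+_ (a 1 * f (+ n))) (ℤₚ.+-identityˡ (remainder 1 n)) ⟩
      a 1 * f (+ n) + remainder 1 n  ≡⟨ f-suc (ℕₚ.≤-trans (s≤s z≤n) 2≤k) n ⟨
      f (+ suc n)                    ∎

    defect≡state′ : ∀ i → 2 ℕ.≤ i → i ℕ.≤ k → defect i (suc n) ≡ state (pred i) (suc n)
    defect≡state′ i 2≤i i≤k = begin
      defect i (suc n)
        ≡⟨ defect-suc i 2≤k 2≤i′ i′≤k (sumFrom1 a i) (r-split i 2≤i i≤k) n ⟩
      sumFrom1 a i * desc A n - desc A (suc n) + defect i′ n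
        ≡⟨ cong₂ (λ x y → sumFrom1 a i * x - y + defect i′ n) desc≡f desc≡f′ ⟩
      sumFrom1 a i * f (+ n) - f (+ suc n) + defect i′ n
        ≡⟨ cong (_+_ (sumFrom1 a i * f (+ n) - f (+ suc n))) (defect≡state i′ 2≤i′ i′≤k) ⟩
      sumFrom1 a i * f (+ n) - f (+ suc n) + state (pred i′) n
        ≡⟨ state-next (ℕₚ.≤-trans (s≤s z≤n) 2≤i) i≤k n ⟨
      state (pred i) (suc n) ∎
      where
      i′ = next k i
      2≤i′ = proj₁ (next-bounds 2≤i i≤k)
      i′≤k = proj₂ (next-bounds 2≤i i≤k)

  F≡f : ∀ n → F k (a 1) q r n ≡ f (+ n)
  F≡f n = trans (F≡desc n) (proj₁ (desc≡f×defect≡state n))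

proposition4 : (k : ℕ) → 2 ℕ.≤ k → (a : ℕ → ℤ) → + 0 < a 1 →
    (f : ℤ → ℤ) → (∀ h → h < + 0 → f h ≡ + 0) → f (+ 0) ≡ + 1 →
    (∀ n → 1 ℕ.≤ n → f (+ n) ≡ sumFrom1 (λ l → a l * f (+ n - + l)) k) →
    (q r : ℕ → ℤ) →
    (∀ i → 2 ℕ.≤ i → i ℕ.≤ k →
      (sumFrom1 a i ≤ + 0 → (+ 0 < q i) × (+ 0 < r i) × (+ ∣ sumFrom1 a i ∣ ≡ q i * a 1 - r i))
      × (+ 0 < sumFrom1 a i → (q i ≡ + 0) × (r i ≡ sumFrom1 a i))) →
    ∀ n → F k (a 1) q r n ≡ f (+ n)
proposition4 k 2≤k a _ f f-neg f-init f-rec q r qr =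
  Agreement.F≡f k 2≤k a f f-neg f-init f-rec q r (λ i 2≤i i≤k → r≡q*a+S (qr i 2≤i i≤k))
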